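{- Let $H$ be a graph, let $z\in V(H)$ with $d_H(z)\ge2$, and suppose $H-z$ has no tree components. Let $m_1$ be the number of edges in $H[\Gamma_H(z)]$, let $m_2$ be the number of edges in $H$ between $\Gamma_H(z)$ and $\Gamma^2_H(z)$, and let $r$ be the number of tree components of $H-z-\Gamma_H(z)$. Then $m_1+m_2\ge r+2$.
   Context: $\Gamma_H(z)$ is the set of neighbours of $z$, $d_H(z)=|\Gamma_H(z)|$, and $\Gamma^2_H(z)$ is the set of vertices at distance exactly $2$ from $z$ in $H$. -}

module Defs where

open import Data.Nat using (ℕ; zero; suc; _+_; _≤_)
open import Data.Bool using (Bool; true; false; _∧_; not; if_then_else_)
open import Data.Fin using (Fin; _≟_; _<?_)
open import Data.List using (List; []; _∷_; _++_; length; map)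
open import Data.Nat.ListAction using (sum)
open import Data.Bool.ListAction using (any)
open import Data.List.Relation.Unary.All using (All)
open import Data.List.Relation.Unary.Linked using (Linked)
open import Data.List.Relation.Unary.Unique.Propositional using (Unique)
open import Data.Vec using (Vec; lookup)
open import Data.Product using (Σ; _×_)
open import Relation.Binary.PropositionalEquality using (_≡_)
open import Relation.Nullary using (¬_)
open import Relation.Nullary.Decidable using (⌊_⌋)
import Data.List as L

record Graph (n : ℕ) : Set where
  field
    adj    : Fin n → Fin n → Bool
    sym    : ∀ u v → adj u v ≡ adj v u
    irrefl : ∀ v → adj v v ≡ false
open Graph public

verts : (n : ℕ) → List (Fin n)
verts n = L.allFin n

count : {n : ℕ} → (Fin n → Bool) → ℕ
count {n} p = sum (map (λ v → if p v then 1 else 0) (verts n))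

_==_ : {n : ℕ} → Fin n → Fin n → Bool
u == v = ⌊ u ≟ v ⌋

Γ : {n : ℕ} → Graph n → Fin n → Fin n → Bool
Γ H z v = adj H z v

deg : {n : ℕ} → Graph n → Fin n → ℕ
deg H z = count (Γ H z)

Γ² : {n : ℕ} → Graph n → Fin n → Fin n → Bool
Γ² {n} H z v = not (v == z) ∧ not (adj H z v)
             ∧ any (λ u → adj H z u ∧ adj H u v) (verts n)

m₁ : {n : ℕ} → Graph n → Fin n → ℕ
m₁ H z = sum (map (λ u → count (λ v → ⌊ u <? v ⌋ ∧ Γ H z u ∧ Γ H z v ∧ adj H u v)) (verts _))

-- number of edges of H between Γ(z) and Γ²(z) (these sets are disjoint,
-- so each such edge is counted exactly once by u ∈ Γ(z), w ∈ Γ²(z))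
m₂ : {n : ℕ} → Graph n → Fin n → ℕ
m₂ H z = sum (map (λ u → count (λ w → Γ H z u ∧ Γ² H z w ∧ adj H u w)) (verts _))

minusZ : {n : ℕ} → Graph n → Fin n → Fin n → Bool
minusZ H z v = not (v == z)

minusZΓ : {n : ℕ} → Graph n → Fin n → Fin n → Bool
minusZΓ H z v = not (v == z) ∧ not (adj H z v)

_∈ᵥ_ : {n : ℕ} → Fin n → Vec Bool n → Set
v ∈ᵥ C = lookup C v ≡ true

-- walks from u to v all of whose vertices after the first lie in C
data Walk {n : ℕ} (H : Graph n) (C : Vec Bool n) : Fin n → Fin n → Set where
  []   : ∀ {u} → Walk H C u u
  step : ∀ {u w v} → adj H u w ≡ true → w ∈ᵥ C → Walk H C w v → Walk H C u v

record IsComponent {n : ℕ} (H : Graph n) (S : Fin n → Bool) (C : Vec Bool n) : Set where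
  field
    inS       : ∀ v → v ∈ᵥ C → S v ≡ true
    nonempty  : Σ (Fin n) λ v → v ∈ᵥ C
    connected : ∀ u v → u ∈ᵥ C → v ∈ᵥ C → Walk H C u v
    closed    : ∀ u v → u ∈ᵥ C → S v ≡ true → adj H u v ≡ true → v ∈ᵥ C

HasCycle : {n : ℕ} → Graph n → Vec Bool n → Set
HasCycle {n} H C =
  Σ (Fin n) λ u → Σ (List (Fin n)) λ ws →
    (2 ≤ length ws) × Unique (u ∷ ws) × All (λ v → v ∈ᵥ C) (u ∷ ws)
    × Linked (λ a b → adj H a b ≡ true) (u ∷ ws ++ u ∷ [])

IsTreeComponent : {n : ℕ} → Graph n → (Fin n → Bool) → Vec Bool n → Set
IsTreeComponent H S C = IsComponent H S C × ¬ HasCycle H C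

-- Every tree component T of H - z - Γ(z) is joined to Γ(z) by an edge, for otherwise T would be
-- a tree component of H - z; fixing one such anchor edge per T gives r distinct edges counted by m₂.
-- If at most one further edge were counted by m₁ + m₂, then for suitable neighbours x, y of z the
-- set {x, y} together with the trees anchored at x or y would be closed in H - z, connected, and
-- acyclic, because a cycle never crosses a cut consisting of a single edge: a tree component of
-- H - z, which is excluded.

module Submission where

open import Defs hiding (sym)
open import Data.Nat using (ℕ; suc; _+_; _≤_; z≤n; s≤s)
open import Data.Nat.Properties
  using (module ≤-Reasoning; ≤-pred; ≤-trans; m≤n+m; n≤1+n; +-monoʳ-≤; +-suc; +-comm)
open import Data.Bool using (Bool; true; false; not; _∧_; _∨_; if_then_else_)
open import Data.Bool.Properties
  using (∧-conicalˡ; ∧-conicalʳ; ∨-zeroʳ; not-¬; not-involutive; not-injective)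
  renaming (_≟_ to _≟ᵇ_)
open import Data.Fin using (Fin; _≟_; _<_; _<?_)
open import Data.Fin.Properties using (<-cmp)
open import Data.List using (List; []; _∷_; _++_; length; map; cartesianProduct; allFin)
open import Data.Bool.ListAction using (any)
open import Data.List.Properties
  using (++-assoc; ∷-injectiveʳ; length-map; length-++; length-++-sucʳ; map-++; map-∘)
open import Data.Nat.ListAction using (sum)
open import Data.Nat.ListAction.Properties using (sum-++)
open import Data.List.Relation.Unary.All as All using (All; []; _∷_)
import Data.List.Relation.Unary.All.Properties as All
open import Data.List.Relation.Unary.Any as Any using (Any; here; there; satisfied)
import Data.List.Relation.Unary.Any.Properties as Any
open import Data.List.Relation.Unary.AllPairs using (AllPairs; []; _∷_)
import Data.List.Relation.Unary.AllPairs.Properties as AllPairs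
open import Data.List.Relation.Unary.Linked using (Linked; [-]; _∷_)
open import Data.List.Relation.Unary.Unique.Propositional using (Unique)
open import Data.List.Relation.Unary.Unique.Propositional.Properties using (allFin⁺)
open import Data.List.Membership.Propositional using (_∈_; _∉_; find)
open import Data.List.Membership.Propositional.Properties
  using (∈-++⁺ʳ; ∈-++⁻; ∈-∃++; ∈-allFin; ∈-cartesianProduct⁺; ∈-map⁻)
import Data.List.Membership.DecPropositional as DecMembership
open import Data.Product using (Σ; _×_; _,_; proj₁; proj₂; swap)
open import Data.Product.Properties using (≡-dec)
open import Data.Sum using (_⊎_; inj₁; inj₂)
open import Data.Empty using (⊥; ⊥-elim)
open import Data.Vec using (Vec; lookup; tabulate)
open import Data.Vec.Properties using (tabulate∘lookup; tabulate-cong; lookup∘tabulate)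
open import Relation.Binary.Definitions using (DecidableEquality; tri<; tri≈; tri>)
open import Relation.Binary.PropositionalEquality
  using (_≡_; _≢_; refl; sym; trans; cong; cong₂; subst; subst₂)
open import Relation.Nullary using (¬_; Dec; yes; no; ¬?; _×-dec_)
open import Relation.Nullary.Decidable using (⌊_⌋; dec-true; dec-false; isYes≗does)

∨-true⁻ : ∀ a {b} → a ∨ b ≡ true → a ≡ true ⊎ b ≡ true
∨-true⁻ true  _ = inj₁ refl
∨-true⁻ false e = inj₂ e

∨-trueʳ : ∀ a {b} → b ≡ true → a ∨ b ≡ true
∨-trueʳ a refl = ∨-zeroʳ a

∧₃-true⁻ : ∀ a b c → a ∧ b ∧ c ≡ true → a ≡ true × b ≡ true × c ≡ true
∧₃-true⁻ true true true refl = refl , refl , refl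

false-or-true : ∀ b → b ≡ false ⊎ b ≡ true
false-or-true false = inj₁ refl
false-or-true true  = inj₂ refl

≢-not⇒≡ : ∀ {b c : Bool} → b ≢ not c → b ≡ c
≢-not⇒≡ {false} {false} _  = refl
≢-not⇒≡ {true}  {true}  _  = refl
≢-not⇒≡ {false} {true}  ne = ⊥-elim (ne refl)
≢-not⇒≡ {true}  {false} ne = ⊥-elim (ne refl)

≢⇒≡-not : ∀ {b c : Bool} → b ≢ c → b ≡ not c
≢⇒≡-not {b} {c} ne = ≢-not⇒≡ (λ e → ne (trans e (not-involutive c)))

module _ {n : ℕ} where

  ==⇒≡ : {u v : Fin n} → (u == v) ≡ true → u ≡ v
  ==⇒≡ {u} {v} e with u ≟ v
  ... | yes u≡v = u≡v

  ==-refl : (u : Fin n) → (u == u) ≡ true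
  ==-refl u = trans (isYes≗does (u ≟ u)) (dec-true (u ≟ u) refl)

  ≢⇒==-false : {u v : Fin n} → u ≢ v → (u == v) ≡ false
  ≢⇒==-false {u} {v} u≢v = trans (isYes≗does (u ≟ v)) (dec-false (u ≟ v) u≢v)

  <?-true : {u v : Fin n} → u < v → ⌊ u <? v ⌋ ≡ true
  <?-true {u} {v} u<v = trans (isYes≗does (u <? v)) (dec-true (u <? v) u<v)

any-true⁺ : {A : Set} (p : A → Bool) {x : A} {xs : List A} → x ∈ xs → p x ≡ true → any p xs ≡ true
any-true⁺ p {xs = y ∷ xs} (here refl) px = cong (_∨ any p xs) px
any-true⁺ p {xs = y ∷ xs} (there x∈xs) px = ∨-trueʳ (p y) (any-true⁺ p x∈xs px)

any-true⁻ : {A : Set} (p : A → Bool) (xs : List A) → any p xs ≡ true → Σ A λ x → x ∈ xs × p x ≡ true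
any-true⁻ p (x ∷ xs) e with ∨-true⁻ (p x) e
... | inj₁ px = x , here refl , px
... | inj₂ pxs with any-true⁻ p xs pxs
...   | y , y∈xs , py = y , there y∈xs , py

countᴸ : {A : Set} → (A → Bool) → List A → ℕ
countᴸ g xs = sum (map (λ x → if g x then 1 else 0) xs)

countᴸ-++ : {A : Set} (g : A → Bool) (xs ys : List A) → countᴸ g (xs ++ ys) ≡ countᴸ g xs + countᴸ g ys
countᴸ-++ g xs ys = trans (cong sum (map-++ _ xs ys)) (sum-++ (map _ xs) _)

countᴸ-∨ : {A : Set} (f g : A → Bool) (xs : List A) →
           countᴸ (λ x → f x ∨ g x) xs ≤ countᴸ f xs + countᴸ g xs
countᴸ-∨ f g []       = z≤n
countᴸ-∨ f g (x ∷ xs) with f x | g x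
... | true  | true  = s≤s (≤-trans (countᴸ-∨ f g xs) (+-monoʳ-≤ (countᴸ f xs) (n≤1+n _)))
... | true  | false = s≤s (countᴸ-∨ f g xs)
... | false | true  =
  subst (suc (countᴸ (λ x → f x ∨ g x) xs) ≤_) (sym (+-suc _ _)) (s≤s (countᴸ-∨ f g xs))
... | false | false = countᴸ-∨ f g xs

sum-countᴸ≡countᴸ-cartesianProduct : {A : Set} (g : A → A → Bool) (us vs : List A) →
  sum (map (λ u → countᴸ (g u) vs) us) ≡ countᴸ (λ e → g (proj₁ e) (proj₂ e)) (cartesianProduct us vs)
sum-countᴸ≡countᴸ-cartesianProduct g []       vs = refl
sum-countᴸ≡countᴸ-cartesianProduct g (u ∷ us) vs = trans
  (cong₂ _+_ (cong sum (map-∘ vs)) (sum-countᴸ≡countᴸ-cartesianProduct g us vs))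
  (sym (countᴸ-++ _ (map (u ,_) vs) (cartesianProduct us vs)))

countᴸ-pos⇒witness : {A : Set} (g : A → Bool) (U : List A) → 1 ≤ countᴸ g U →
                     Σ A λ a → a ∈ U × g a ≡ true
countᴸ-pos⇒witness g (a ∷ U) pos with false-or-true (g a)
... | inj₂ ga = a , here refl , ga
... | inj₁ ga rewrite ga with countᴸ-pos⇒witness g U pos
...   | b , b∈U , gb = b , there b∈U , gb

countᴸ≥2⇒two-witnesses : {A : Set} (g : A → Bool) (U : List A) → Unique U → 2 ≤ countᴸ g U →
                         Σ A λ a → Σ A λ b → a ≢ b × g a ≡ true × g b ≡ true
countᴸ≥2⇒two-witnesses g (a ∷ U) (a∉U ∷ uq) two with false-or-true (g a)
... | inj₁ ga rewrite ga = countᴸ≥2⇒two-witnesses g U uq two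
... | inj₂ ga rewrite ga with countᴸ-pos⇒witness g U (≤-pred two)
...   | b , b∈U , gb = a , b , All.lookup a∉U b∈U , ga , gb

∈-∷-≢ : {A : Set} {x a : A} {U : List A} → x ∈ a ∷ U → x ≢ a → x ∈ U
∈-∷-≢ (here x≡a) x≢a = ⊥-elim (x≢a x≡a)
∈-∷-≢ (there x∈U) _  = x∈U

All-remove : {A : Set} {P : A → Set} (L₁ : List A) {a : A} {L₂ : List A} →
             All P (L₁ ++ a ∷ L₂) → All P (L₁ ++ L₂)
All-remove L₁ ps with All.++⁻ L₁ ps
... | ps₁ , _ ∷ ps₂ = All.++⁺ ps₁ ps₂

Unique-remove : {A : Set} (L₁ : List A) {a : A} {L₂ : List A} → Unique (L₁ ++ a ∷ L₂) →
                Unique (L₁ ++ L₂) × All (_≢ a) (L₁ ++ L₂)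
Unique-remove []       (a∉ ∷ uq) = uq , All.map (λ a≢x x≡a → a≢x (sym x≡a)) a∉
Unique-remove (x ∷ L₁) (x∉ ∷ uq) with Unique-remove L₁ uq
... | uq′ , ≢a = (All-remove L₁ x∉ ∷ uq′) , All.lookup x∉ (∈-++⁺ʳ L₁ (here refl)) ∷ ≢a

module _ {A : Set} (_≟ᴬ_ : DecidableEquality A) (g : A → Bool) where
  open DecMembership _≟ᴬ_ using (_∈?_)

  unique⇒length≤countᴸ : (U L : List A) → Unique L → All (_∈ U) L →
                         All (λ x → g x ≡ true) L → length L ≤ countᴸ g U
  unique⇒length≤countᴸ []      []      _  _        _  = z≤n
  unique⇒length≤countᴸ []      (_ ∷ _) _  (() ∷ _) _
  unique⇒length≤countᴸ (a ∷ U) L       uq L⊆aU    gL with a ∈? L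
  ... | yes a∈L with ∈-∃++ a∈L
  ...   | L₁ , L₂ , refl with Unique-remove L₁ uq
  ...     | uq′ , ≢a rewrite length-++-sucʳ L₁ a L₂ | All.lookup gL a∈L =
    s≤s (unique⇒length≤countᴸ U (L₁ ++ L₂) uq′
           (All.zipWith (λ (x∈aU , x≢a) → ∈-∷-≢ x∈aU x≢a) (All-remove L₁ L⊆aU , ≢a))
           (All-remove L₁ gL))
  unique⇒length≤countᴸ (a ∷ U) L uq L⊆aU gL | no a∉L =
    ≤-trans (unique⇒length≤countᴸ U L uq L⊆U gL) (m≤n+m _ _)
    where
    L⊆U : All (_∈ U) L
    L⊆U = All.tabulate λ x∈L →
      ∈-∷-≢ (All.lookup L⊆aU x∈L) (λ x≡a → a∉L (subst (_∈ L) x≡a x∈L))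

module Walks {n : ℕ} (H : Graph n) where

  _++ʷ_ : ∀ {C a b c} → Walk H C a b → Walk H C b c → Walk H C a c
  []             ++ʷ W = W
  step ab bC V ++ʷ W = step ab bC (V ++ʷ W)

  reverseʷ : ∀ {C a b} → Walk H C a b → a ∈ᵥ C → Walk H C b a
  reverseʷ []                       _  = []
  reverseʷ (step {a} {w} aw wC W) aC = reverseʷ W wC ++ʷ step (trans (Graph.sym H w a) aw) aC []

  mapʷ : ∀ {C C′ a b} → (∀ v → v ∈ᵥ C → v ∈ᵥ C′) → Walk H C a b → Walk H C′ a b
  mapʷ C⊆C′ []             = []
  mapʷ C⊆C′ (step aw wC W) = step aw (C⊆C′ _ wC) (mapʷ C⊆C′ W)

  component-closed-under-walks : ∀ {S T C a b} → IsComponent H S T → (∀ v → v ∈ᵥ C → S v ≡ true) →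
                                 Walk H C a b → a ∈ᵥ T → b ∈ᵥ T
  component-closed-under-walks T-comp C⊆S []                       aT = aT
  component-closed-under-walks T-comp C⊆S (step {a} {w} aw wC W) aT =
    component-closed-under-walks T-comp C⊆S W (IsComponent.closed T-comp a w aT (C⊆S w wC) aw)

  components-meet⇒≡ : ∀ {S T T′} → IsComponent H S T → IsComponent H S T′ →
                      ∀ v → v ∈ᵥ T → v ∈ᵥ T′ → T ≡ T′
  components-meet⇒≡ {S} {T} {T′} T-comp T′-comp v vT vT′ =
    trans (sym (tabulate∘lookup T)) (trans (tabulate-cong pointwise) (tabulate∘lookup T′))
    where
    T⊆T′ : ∀ w → w ∈ᵥ T → w ∈ᵥ T′
    T⊆T′ w wT = component-closed-under-walks T′-comp (IsComponent.inS T-comp)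
                  (IsComponent.connected T-comp v w vT wT) vT′
    T′⊆T : ∀ w → w ∈ᵥ T′ → w ∈ᵥ T
    T′⊆T w wT′ = component-closed-under-walks T-comp (IsComponent.inS T′-comp)
                   (IsComponent.connected T′-comp v w vT′ wT′) vT
    pointwise : ∀ w → lookup T w ≡ lookup T′ w
    pointwise w with false-or-true (lookup T w) | false-or-true (lookup T′ w)
    ... | inj₁ wT | inj₁ wT′ = trans wT (sym wT′)
    ... | inj₂ wT | inj₂ wT′ = trans wT (sym wT′)
    ... | inj₂ wT | inj₁ wT′ = ⊥-elim (not-¬ (T⊆T′ w wT) wT′)
    ... | inj₁ wT | inj₂ wT′ = ⊥-elim (not-¬ (T′⊆T w wT′) wT)

module Cycles {n : ℕ} (H : Graph n) where

  Adj : Fin n → Fin n → Set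
  Adj a b = adj H a b ≡ true

  adj-sym : ∀ {a b} → Adj a b → Adj b a
  adj-sym {a} {b} ab = trans (Graph.sym H b a) ab

  record Cycle (P : Fin n → Set) : Set where
    constructor cycle
    field
      start    : Fin n
      rest     : List (Fin n)
      long     : 2 ≤ length rest
      distinct : Unique (start ∷ rest)
      inside   : All P (start ∷ rest)
      links    : Linked Adj (start ∷ rest ++ start ∷ [])

    vertices : List (Fin n)
    vertices = start ∷ rest
  open Cycle public

  restrict : ∀ {P Q : Fin n → Set} (c : Cycle P) → All Q (vertices c) → Cycle Q
  restrict (cycle u ws l uq _ lk) Qs = cycle u ws l uq Qs lk

  Cycle⇒HasCycle : ∀ {C} → Cycle (_∈ᵥ C) → HasCycle H C
  Cycle⇒HasCycle (cycle u ws l uq Cs lk) = u , ws , l , uq , Cs , lk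

  HasCycle⇒Cycle : ∀ {C} → HasCycle H C → Cycle (_∈ᵥ C)
  HasCycle⇒Cycle (u , ws , l , uq , Cs , lk) = cycle u ws l uq Cs lk

  ¬cycle-within-pair : ∀ {P : Fin n → Set} (c : Cycle P) (x y : Fin n) →
                       ¬ All (λ v → v ≡ x ⊎ v ≡ y) (vertices c)
  ¬cycle-within-pair
    (cycle u (w₁ ∷ w₂ ∷ _) (s≤s (s≤s _)) ((u≢w₁ ∷ u≢w₂ ∷ _) ∷ (w₁≢w₂ ∷ _) ∷ _) _ _) x y
    (u∈ ∷ w₁∈ ∷ w₂∈ ∷ _) = pigeonhole u∈ w₁∈ w₂∈
    where
    pigeonhole : _ → _ → _ → ⊥
    pigeonhole (inj₁ refl) (inj₁ refl) _           = u≢w₁ refl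
    pigeonhole (inj₂ refl) (inj₂ refl) _           = u≢w₁ refl
    pigeonhole (inj₁ refl) _           (inj₁ refl) = u≢w₂ refl
    pigeonhole (inj₂ refl) _           (inj₂ refl) = u≢w₂ refl
    pigeonhole _           (inj₁ refl) (inj₁ refl) = w₁≢w₂ refl
    pigeonhole _           (inj₂ refl) (inj₂ refl) = w₁≢w₂ refl

  OnlyCrossing : (P : Fin n → Set) (f : Fin n → Bool) (a b : Fin n) → Set
  OnlyCrossing P f a b = ∀ p q → P p → P q → f p ≡ true → f q ≡ false → Adj p q → p ≡ a × q ≡ b

  private
    Linked-snoc : ∀ x xs u y → Linked Adj (x ∷ xs ++ u ∷ []) → Adj u y →
                  Linked Adj (x ∷ xs ++ u ∷ y ∷ [])
    Linked-snoc x []       u y (xu ∷ [-]) uy = xu ∷ uy ∷ [-]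
    Linked-snoc x (w ∷ xs) u y (xw ∷ lk)  uy = xw ∷ Linked-snoc w xs u y lk uy

    Unique-rotate : ∀ (u : Fin n) xs → Unique (u ∷ xs) → Unique (xs ++ u ∷ [])
    Unique-rotate u []       _                         = [] ∷ []
    Unique-rotate u (x ∷ xs) ((u≢x ∷ u∉) ∷ (x∉ ∷ uq)) =
      All.++⁺ x∉ ((λ x≡u → u≢x (sym x≡u)) ∷ []) ∷ Unique-rotate u xs (u∉ ∷ uq)

    rotate : ∀ {P : Fin n → Set} (c : Cycle P) (w : Fin n) (ws : List (Fin n)) → rest c ≡ w ∷ ws →
             Σ (Cycle P) λ c′ → start c′ ≡ w × rest c′ ≡ ws ++ start c ∷ []
    rotate (cycle u .(w ∷ ws) (s≤s l) uq (pu ∷ pw ∷ ps) (uw ∷ lk)) w ws refl =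
      cycle w (ws ++ u ∷ [])
        (subst (2 ≤_) (trans (+-comm 1 (length ws)) (sym (length-++ ws))) (s≤s l))
        (Unique-rotate u (w ∷ ws) uq)
        (pw ∷ All.++⁺ ps (pu ∷ []))
        (subst (λ vs → Linked Adj (w ∷ vs)) (sym (++-assoc ws (u ∷ []) (w ∷ [])))
               (Linked-snoc w ws u w lk uw))
      , refl , refl

    split-at-first : (g : Fin n → Bool) (γ : Bool) (ws : List (Fin n)) → Any (λ v → g v ≡ γ) ws →
                     Σ (List (Fin n)) λ xs → Σ (Fin n) λ v → Σ (List (Fin n)) λ ys →
                     ws ≡ xs ++ v ∷ ys × g v ≡ γ × All (λ x → g x ≡ not γ) xs
    split-at-first g γ (w ∷ ws) gws with g w ≟ᵇ γ
    ... | yes gw≡γ = [] , w , ws , refl , gw≡γ , []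
    split-at-first g γ (w ∷ ws) (here gw≡γ) | no gw≢γ = ⊥-elim (gw≢γ gw≡γ)
    split-at-first g γ (w ∷ ws) (there gws) | no gw≢γ with split-at-first g γ ws gws
    ... | xs , v , ys , eq , gv , gxs = w ∷ xs , v , ys , cong (w ∷_) eq , gv , ≢⇒≡-not gw≢γ ∷ gxs

    rotate-to-crossing : ∀ {P : Fin n → Set} (f : Fin n → Bool) (β : Bool) (c : Cycle P) →
      f (start c) ≡ β → ∀ xs v ys → rest c ≡ xs ++ v ∷ ys → All (λ x → f x ≡ β) xs → f v ≡ not β →
      Σ (Cycle P) λ c′ → f (start c′) ≡ β ×
        Σ (Fin n) λ t → Σ (List (Fin n)) λ ws → rest c′ ≡ t ∷ ws × f t ≡ not β
    rotate-to-crossing f β c fu []       v ys eq _          fv = c , fu , v , ys , eq , fv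
    rotate-to-crossing f β c fu (x ∷ xs) v ys eq (fx ∷ fxs) fv with rotate c x (xs ++ v ∷ ys) eq
    ... | c′ , u′≡x , eq′ =
      rotate-to-crossing f β c′ (trans (cong f u′≡x) fx) xs v (ys ++ start c ∷ [])
        (trans eq′ (++-assoc xs (v ∷ ys) (start c ∷ []))) fxs fv

    crossing-step : ∀ {P : Fin n → Set} (f : Fin n → Bool) (γ : Bool) (x : Fin n) (xs : List (Fin n)) →
      Linked Adj (x ∷ xs) → All P (x ∷ xs) → f x ≡ γ → Any (λ v → f v ≡ not γ) xs →
      Σ (List (Fin n)) λ M₁ → Σ (Fin n) λ p → Σ (Fin n) λ q → Σ (List (Fin n)) λ M₂ →
        x ∷ xs ≡ M₁ ++ p ∷ q ∷ M₂ × f p ≡ γ × f q ≡ not γ × Adj p q × P p × P q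
    crossing-step f γ x (y ∷ ys) (xy ∷ lk) (px ∷ py ∷ ps) fx fys with f y ≟ᵇ not γ
    ... | yes fy = [] , x , y , ys , refl , fx , fy , xy , px , py
    crossing-step f γ x (y ∷ ys) (xy ∷ lk) (px ∷ py ∷ ps) fx (here fy)   | no fy≢ = ⊥-elim (fy≢ fy)
    crossing-step f γ x (y ∷ ys) (xy ∷ lk) (px ∷ py ∷ ps) fx (there fys) | no fy≢
      with crossing-step f γ y ys lk (py ∷ ps) (≢-not⇒≡ fy≢) fys
    ... | M₁ , p , q , M₂ , eq , rest′ = x ∷ M₁ , p , q , M₂ , cong (x ∷_) eq , rest′

    no-return-step : ∀ (u t : Fin n) ws M₁ M₂ → Unique (u ∷ t ∷ ws) → 1 ≤ length ws →
                     t ∷ ws ++ u ∷ [] ≢ M₁ ++ t ∷ u ∷ M₂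
    no-return-step u t (w ∷ ws) []       M₂ ((_ ∷ u≢w ∷ _) ∷ _)       _ refl = u≢w refl
    no-return-step u t ws       (m ∷ M₁) M₂ ((u≢t ∷ _) ∷ (t∉ws ∷ _)) _ eq
      with ∈-++⁻ ws {u ∷ []} (subst (t ∈_) (sym (∷-injectiveʳ eq)) (∈-++⁺ʳ M₁ (here refl)))
    ... | inj₁ t∈ws         = All.lookup t∉ws t∈ws refl
    ... | inj₂ (here t≡u) = u≢t (sym t≡u)

    reverse-crossing : ∀ {P : Fin n → Set} f a b → OnlyCrossing P f a b →
      ∀ x y → P x → P y → Adj x y → (β : Bool) → f x ≡ β → f y ≡ not β →
      ∀ p q → P p → P q → f p ≡ not β → f q ≡ β → Adj p q → p ≡ y × q ≡ x
    reverse-crossing f a b only x y px py xy true fx fy p q pp pq fp fq pq-adj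
      with only x y px py fx fy xy | only q p pq pp fq fp (adj-sym pq-adj)
    ... | refl , refl | refl , refl = refl , refl
    reverse-crossing f a b only x y px py xy false fx fy p q pp pq fp fq pq-adj
      with only y x py px fy fx (adj-sym xy) | only p q pp pq fp fq pq-adj
    ... | refl , refl | refl , refl = refl , refl

    cycle-crossing⇒⊥ : ∀ {P : Fin n → Set} f a b → OnlyCrossing P f a b →
      (β : Bool) (c : Cycle P) (t : Fin n) (ws : List (Fin n)) →
      rest c ≡ t ∷ ws → f (start c) ≡ β → f t ≡ not β → ⊥
    cycle-crossing⇒⊥ f a b only β (cycle u .(t ∷ ws) (s≤s l) uq (pu ∷ pt ∷ ps) (ut ∷ lk)) t ws refl
                     fu ft
      with crossing-step f (not β) t (ws ++ u ∷ []) lk (pt ∷ All.++⁺ ps (pu ∷ [])) ft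
             (Any.++⁺ʳ ws (here (trans fu (sym (not-involutive β)))))
    ... | M₁ , p , q , M₂ , eq , fp , fq , pq , pp , pq′
      with reverse-crossing f a b only u t pu pt ut β fu ft p q pp pq′ fp (trans fq (not-involutive β)) pq
    ... | refl , refl = no-return-step u t ws M₁ M₂ uq l eq

  -- A cycle crosses every cut an even number of times, so it never crosses a cut with one edge.
  cycle-monochromatic : ∀ {P : Fin n → Set} (f : Fin n → Bool) (a b : Fin n) → OnlyCrossing P f a b →
                        (c : Cycle P) → All (λ v → f v ≡ f (start c)) (vertices c)
  cycle-monochromatic f a b only c with All.all? (λ v → f v ≟ᵇ f (start c)) (vertices c)
  ... | yes mono = mono
  ... | no ¬mono with All.¬All⇒Any¬ (λ v → f v ≟ᵇ f (start c)) (vertices c) ¬mono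
  ... | here fu≢fu = ⊥-elim (fu≢fu refl)
  ... | there other with split-at-first f (not (f (start c))) (rest c) (Any.map ≢⇒≡-not other)
  ... | xs , v , ys , eq , fv , fxs
      with rotate-to-crossing f (f (start c)) c refl xs v ys eq
             (All.map (λ fx → trans fx (not-involutive _)) fxs) fv
  ... | c′ , fu′ , t , ws , eq′ , ft =
    ⊥-elim (cycle-crossing⇒⊥ f a b only (f (start c)) c′ t ws eq′ fu′ ft)

  cycle-on-one-side : ∀ {P : Fin n → Set} (f : Fin n → Bool) (a b : Fin n) → OnlyCrossing P f a b →
    (c : Cycle P) → All (λ v → f v ≡ true) (vertices c) ⊎ All (λ v → f v ≡ false) (vertices c)
  cycle-on-one-side f a b only c with false-or-true (f (start c))
  ... | inj₁ fu = inj₂ (All.map (λ fv → trans fv fu) (cycle-monochromatic f a b only c))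
  ... | inj₂ fu = inj₁ (All.map (λ fv → trans fv fu) (cycle-monochromatic f a b only c))

unattached⇒component-minusZ : ∀ {n} (H : Graph n) (z : Fin n) {T : Vec Bool n} →
  IsComponent H (minusZΓ H z) T →
  (∀ t v → t ∈ᵥ T → adj H z v ≡ true → adj H t v ≡ true → ⊥) →
  IsComponent H (minusZ H z) T
unattached⇒component-minusZ H z {T} T-comp unattached = record
  { inS       = λ v vT → ∧-conicalˡ _ _ (inS v vT)
  ; nonempty  = nonempty
  ; connected = connected
  ; closed    = closed′
  }
  where
  open IsComponent T-comp
  closed′ : ∀ u v → u ∈ᵥ T → minusZ H z v ≡ true → adj H u v ≡ true → v ∈ᵥ T
  closed′ u v uT v≢z uv with false-or-true (adj H z v)
  ... | inj₁ zv = closed u v uT (cong₂ _∧_ v≢z (cong not zv)) uv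
  ... | inj₂ zv = ⊥-elim (unattached u v uT zv uv)

module TreeComponentsOfH-z-Γ {n : ℕ} (H : Graph n) (z : Fin n)
  (no-tree : ∀ C → ¬ IsTreeComponent H (minusZ H z) C)
  (Cs : List (Vec Bool n)) (trees : All (IsTreeComponent H (minusZΓ H z)) Cs) where

  open Walks H
  open Cycles H

  Pair : Set
  Pair = Fin n × Fin n

  pairs : List Pair
  pairs = cartesianProduct (allFin n) (allFin n)

  ∈-pairs : ∀ e → e ∈ pairs
  ∈-pairs (a , b) = ∈-cartesianProduct⁺ (∈-allFin a) (∈-allFin b)

  _≟ᵖ_ : DecidableEquality Pair
  _≟ᵖ_ = ≡-dec _≟_ _≟_

  ΓΓ-edge : Pair → Bool
  ΓΓ-edge (u , v) = ⌊ u <? v ⌋ ∧ Γ H z u ∧ Γ H z v ∧ adj H u v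

  ΓΓ²-edge : Pair → Bool
  ΓΓ²-edge (u , w) = Γ H z u ∧ Γ² H z w ∧ adj H u w

  counted : Pair → Bool
  counted e = ΓΓ-edge e ∨ ΓΓ²-edge e

  countᴸ-counted≤m₁+m₂ : countᴸ counted pairs ≤ m₁ H z + m₂ H z
  countᴸ-counted≤m₁+m₂ = subst₂ (λ a b → countᴸ counted pairs ≤ a + b)
    (sym (sum-countᴸ≡countᴸ-cartesianProduct (λ u v → ΓΓ-edge (u , v)) (allFin n) (allFin n)))
    (sym (sum-countᴸ≡countᴸ-cartesianProduct (λ u w → ΓΓ²-edge (u , w)) (allFin n) (allFin n)))
    (countᴸ-∨ ΓΓ-edge ΓΓ²-edge pairs)

  Γ²-intro : ∀ {x t} → adj H z x ≡ true → adj H x t ≡ true →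
             not (t == z) ≡ true → adj H z t ≡ false → Γ² H z t ≡ true
  Γ²-intro {x} {t} zx xt t≢z zt = cong₂ _∧_ t≢z (cong₂ _∧_ (cong not zt)
    (any-true⁺ (λ u → adj H z u ∧ adj H u t) (∈-allFin x) (cong₂ _∧_ zx xt)))

  Γ²⇒∉Γ : ∀ {t} → Γ² H z t ≡ true → adj H z t ≡ false
  Γ²⇒∉Γ {t} Γ²t = not-injective (proj₁ (proj₂ (∧₃-true⁻ (not (t == z)) (not (adj H z t)) _ Γ²t)))

  ΓΓ²-intro : ∀ {x t} → adj H z x ≡ true → adj H x t ≡ true →
              not (t == z) ≡ true → adj H z t ≡ false → ΓΓ²-edge (x , t) ≡ true
  ΓΓ²-intro zx xt t≢z zt = cong₂ _∧_ zx (cong₂ _∧_ (Γ²-intro zx xt t≢z zt) xt)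

  ΓΓ-intro : ∀ {a b} → adj H z a ≡ true → adj H z b ≡ true → adj H a b ≡ true →
             ΓΓ-edge (a , b) ≡ true ⊎ ΓΓ-edge (b , a) ≡ true
  ΓΓ-intro {a} {b} za zb ab with <-cmp a b
  ... | tri< a<b _ _ = inj₁ (cong₂ _∧_ (<?-true a<b) (cong₂ _∧_ za (cong₂ _∧_ zb ab)))
  ... | tri> _ _ b<a = inj₂ (cong₂ _∧_ (<?-true b<a) (cong₂ _∧_ zb (cong₂ _∧_ za (adj-sym ab))))
  ... | tri≈ _ refl _ = ⊥-elim (not-¬ ab (Graph.irrefl H a))

  module _ {T : Vec Bool n} (T∈ : T ∈ Cs) where

    private
      T-comp : IsComponent H (minusZΓ H z) T
      T-comp = proj₁ (All.lookup trees T∈)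

    tree-acyclic : ¬ HasCycle H T
    tree-acyclic = proj₂ (All.lookup trees T∈)

    tree-closed : ∀ u v → u ∈ᵥ T → not (v == z) ≡ true → adj H z v ≡ false → adj H u v ≡ true →
                  v ∈ᵥ T
    tree-closed u v uT v≢z zv = IsComponent.closed T-comp u v uT (cong₂ _∧_ v≢z (cong not zv))

    tree-connected : ∀ u v → u ∈ᵥ T → v ∈ᵥ T → Walk H T u v
    tree-connected = IsComponent.connected T-comp

    tree-vertex-≢z : ∀ {v} → v ∈ᵥ T → not (v == z) ≡ true
    tree-vertex-≢z vT = ∧-conicalˡ _ _ (IsComponent.inS T-comp _ vT)

    tree-vertex-∉Γ : ∀ {v} → v ∈ᵥ T → adj H z v ≡ false
    tree-vertex-∉Γ vT = not-injective (∧-conicalʳ _ _ (IsComponent.inS T-comp _ vT))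

    ΓΓ²-edge-into-tree : ∀ {x t} → t ∈ᵥ T → adj H z x ≡ true → adj H x t ≡ true →
                         ΓΓ²-edge (x , t) ≡ true
    ΓΓ²-edge-into-tree tT zx xt = ΓΓ²-intro zx xt (tree-vertex-≢z tT) (tree-vertex-∉Γ tT)

  same-tree : ∀ {T T′} → T ∈ Cs → T′ ∈ Cs → ∀ v → v ∈ᵥ T → v ∈ᵥ T′ → T ≡ T′
  same-tree T∈ T′∈ = components-meet⇒≡ (proj₁ (All.lookup trees T∈)) (proj₁ (All.lookup trees T′∈))

  Attachment : Vec Bool n → Pair → Bool
  Attachment T e = adj H z (proj₁ e) ∧ lookup T (proj₂ e) ∧ adj H (proj₁ e) (proj₂ e)

  attachment-exists : ∀ {T} → T ∈ Cs → Any (λ e → Attachment T e ≡ true) pairs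
  attachment-exists {T} T∈ with Any.any? (λ e → Attachment T e ≟ᵇ true) pairs
  ... | yes found = found
  ... | no none   = ⊥-elim (no-tree T
    (unattached⇒component-minusZ H z (proj₁ (All.lookup trees T∈)) unattached , tree-acyclic T∈))
    where
    unattached : ∀ t v → t ∈ᵥ T → adj H z v ≡ true → adj H t v ≡ true → ⊥
    unattached t v tT zv tv =
      none (Any.map (λ { refl → cong₂ _∧_ zv (cong₂ _∧_ tT (adj-sym tv)) }) (∈-pairs (v , t)))

  -- (z , z) is a junk value: every T ∈ Cs has an attachment, by attachment-exists.
  anchor : Vec Bool n → Pair
  anchor T with Any.any? (λ e → Attachment T e ≟ᵇ true) pairs
  ... | yes found = proj₁ (satisfied found)
  ... | no  _     = z , z

  root foot : Vec Bool n → Fin n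
  root T = proj₁ (anchor T)
  foot T = proj₂ (anchor T)

  anchor-attaches : ∀ {T} → T ∈ Cs → Attachment T (anchor T) ≡ true
  anchor-attaches {T} T∈ with Any.any? (λ e → Attachment T e ≟ᵇ true) pairs
  ... | yes found = proj₂ (satisfied found)
  ... | no  none  = ⊥-elim (none (attachment-exists T∈))

  module _ {T : Vec Bool n} (T∈ : T ∈ Cs) where

    private
      anchor-facts : adj H z (root T) ≡ true × foot T ∈ᵥ T × adj H (root T) (foot T) ≡ true
      anchor-facts = ∧₃-true⁻ _ _ _ (anchor-attaches T∈)

    root-∈Γ : adj H z (root T) ≡ true
    root-∈Γ = proj₁ anchor-facts

    foot-∈T : foot T ∈ᵥ T
    foot-∈T = proj₁ (proj₂ anchor-facts)

    root-foot-adj : adj H (root T) (foot T) ≡ true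
    root-foot-adj = proj₂ (proj₂ anchor-facts)

  anchors : List Pair
  anchors = map anchor Cs

  anchor-ΓΓ² : ∀ {e} → e ∈ anchors → ΓΓ²-edge e ≡ true
  anchor-ΓΓ² e∈ with ∈-map⁻ anchor e∈
  ... | T , T∈ , refl = ΓΓ²-edge-into-tree T∈ (foot-∈T T∈) (root-∈Γ T∈) (root-foot-adj T∈)

  anchor-of-tree : ∀ {e} → e ∈ anchors →
                   Σ (Vec Bool n) λ T → T ∈ Cs × proj₂ e ∈ᵥ T × root T ≡ proj₁ e
  anchor-of-tree e∈ with ∈-map⁻ anchor e∈
  ... | T , T∈ , refl = T , T∈ , foot-∈T T∈ , refl

  anchor-into-tree : ∀ {T v t} → T ∈ Cs → t ∈ᵥ T → (v , t) ∈ anchors → anchor T ≡ (v , t)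
  anchor-into-tree {T} {t = t} T∈ tT e∈ with ∈-map⁻ anchor e∈
  ... | T′ , T′∈ , refl with same-tree T∈ T′∈ t tT (foot-∈T T′∈)
  ...   | refl = refl

  anchor-injective : ∀ {T T′} → T ∈ Cs → T′ ∈ Cs → anchor T ≡ anchor T′ → T ≡ T′
  anchor-injective {T′ = T′} T∈ T′∈ eq =
    same-tree T∈ T′∈ _ (foot-∈T T∈) (subst (_∈ᵥ T′) (cong proj₂ (sym eq)) (foot-∈T T′∈))

  anchors-unique : Unique Cs → Unique anchors
  anchors-unique uq = AllPairs.map⁺ (distinct-anchors uq (All.tabulate (λ T∈ → T∈)))
    where
    distinct-anchors : ∀ {Ds} → Unique Ds → All (_∈ Cs) Ds →
                       AllPairs (λ T T′ → anchor T ≢ anchor T′) Ds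
    distinct-anchors []          []           = []
    distinct-anchors (D∉ ∷ uq) (D∈ ∷ Ds⊆) =
      All.zipWith (λ (D≢T , T∈) eq → D≢T (anchor-injective D∈ T∈ eq)) (D∉ , Ds⊆)
      ∷ distinct-anchors uq Ds⊆

  ΓΓ-edge⁻ : ∀ e → ΓΓ-edge e ≡ true →
             adj H z (proj₁ e) ≡ true × adj H z (proj₂ e) ≡ true × adj H (proj₁ e) (proj₂ e) ≡ true
  ΓΓ-edge⁻ (u , v) q with ⌊ u <? v ⌋
  ... | true = ∧₃-true⁻ _ _ _ q

  ΓΓ²-edge⁻ : ∀ e → ΓΓ²-edge e ≡ true →
              adj H z (proj₁ e) ≡ true × adj H z (proj₂ e) ≡ false × adj H (proj₁ e) (proj₂ e) ≡ true
  ΓΓ²-edge⁻ e q with ∧₃-true⁻ _ _ _ q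
  ... | zx , Γ²t , xt = zx , Γ²⇒∉Γ Γ²t , xt

  ΓΓ²-edge⇒¬ΓΓ-edge : ∀ e → ΓΓ²-edge e ≡ true → ΓΓ-edge e ≡ false
  ΓΓ²-edge⇒¬ΓΓ-edge e q² with false-or-true (ΓΓ-edge e)
  ... | inj₁ ¬q = ¬q
  ... | inj₂ q  =
    ⊥-elim (not-¬ (proj₁ (proj₂ (ΓΓ-edge⁻ e q))) (proj₁ (proj₂ (ΓΓ²-edge⁻ e q²))))

  ΓΓ-edge-∉anchors : ∀ {e} → ΓΓ-edge e ≡ true → e ∉ anchors
  ΓΓ-edge-∉anchors {e} q e∈ = not-¬ q (ΓΓ²-edge⇒¬ΓΓ-edge e (anchor-ΓΓ² e∈))

  SinglyAttached : Vec Bool n → Set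
  SinglyAttached T =
    ∀ t v → t ∈ᵥ T → adj H z v ≡ true → adj H t v ≡ true → v ≡ root T × t ≡ foot T

  entered-only-by-anchors⇒singly-attached : ∀ {T} → T ∈ Cs →
    (∀ v t → t ∈ᵥ T → ΓΓ²-edge (v , t) ≡ true → (v , t) ∈ anchors) → SinglyAttached T
  entered-only-by-anchors⇒singly-attached T∈ only t v tT zv tv
    with anchor-into-tree T∈ tT (only v t tT (ΓΓ²-edge-into-tree T∈ tT zv (adj-sym tv)))
  ... | eq = cong proj₁ (sym eq) , cong proj₂ (sym eq)

  singly-attached⇒only-crossing : ∀ {P : Fin n → Set} → (∀ v → P v → not (v == z) ≡ true) →
    ∀ {T} → T ∈ Cs → SinglyAttached T → OnlyCrossing P (lookup T) (foot T) (root T)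
  singly-attached⇒only-crossing P≢z T∈ single p q _ Pq pT qT pq with false-or-true (adj H z q)
  ... | inj₂ zq = swap (single p q pT zq pq)
  ... | inj₁ zq = ⊥-elim (not-¬ (tree-closed T∈ p q pT (P≢z q Pq) zq pq) qT)

  cycle-avoids-singly-attached : ∀ {P : Fin n → Set} → (∀ v → P v → not (v == z) ≡ true) →
    ∀ {T} → T ∈ Cs → SinglyAttached T → (c : Cycle P) → ¬ Any (_∈ᵥ T) (vertices c)
  cycle-avoids-singly-attached P≢z {T} T∈ single c meets
    with cycle-on-one-side (lookup T) (foot T) (root T) (singly-attached⇒only-crossing P≢z T∈ single) c
  ... | inj₁ inside-T  = tree-acyclic T∈ (Cycle⇒HasCycle {C = T} (restrict c inside-T))
  ... | inj₂ outside-T = All.All¬⇒¬Any (All.map (λ vT∉ vT → not-¬ vT vT∉) outside-T) meets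

  module Branch (x y : Fin n) (zx : adj H z x ≡ true) (zy : adj H z y ≡ true) where

    at-xy : Fin n → Bool
    at-xy v = (v == x) ∨ (v == y)

    hangs : Vec Bool n → Bool
    hangs T = at-xy (root T)

    in-branch : Fin n → Bool
    in-branch v = at-xy v ∨ any (λ T → lookup T v ∧ hangs T) Cs

    branch : Vec Bool n
    branch = tabulate in-branch

    at-xy⁻ : ∀ {v} → at-xy v ≡ true → v ≡ x ⊎ v ≡ y
    at-xy⁻ {v} e with ∨-true⁻ (v == x) e
    ... | inj₁ v≡x = inj₁ (==⇒≡ v≡x)
    ... | inj₂ v≡y = inj₂ (==⇒≡ v≡y)

    at-x : at-xy x ≡ true
    at-x = cong (_∨ (x == y)) (==-refl x)

    at-y : at-xy y ≡ true
    at-y = ∨-trueʳ (y == x) (==-refl y)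

    at-xy⇒∈Γ : ∀ {v} → at-xy v ≡ true → adj H z v ≡ true
    at-xy⇒∈Γ {v} e with at-xy⁻ {v} e
    ... | inj₁ refl = zx
    ... | inj₂ refl = zy

    Hanging : Fin n → Set
    Hanging v = Σ (Vec Bool n) λ T → T ∈ Cs × v ∈ᵥ T × hangs T ≡ true

    branch⁻ : ∀ {v} → v ∈ᵥ branch → at-xy v ≡ true ⊎ Hanging v
    branch⁻ {v} v∈ with ∨-true⁻ (at-xy v) (trans (sym (lookup∘tabulate in-branch v)) v∈)
    ... | inj₁ at = inj₁ at
    ... | inj₂ hanging with any-true⁻ (λ T → lookup T v ∧ hangs T) Cs hanging
    ...   | T , T∈ , vT∧h = inj₂ (T , T∈ , ∧-conicalˡ _ _ vT∧h , ∧-conicalʳ (lookup T v) _ vT∧h)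

    at-xy⇒∈branch : ∀ {v} → at-xy v ≡ true → v ∈ᵥ branch
    at-xy⇒∈branch {v} at =
      trans (lookup∘tabulate in-branch v) (cong (_∨ any (λ T → lookup T v ∧ hangs T) Cs) at)

    hanging⇒∈branch : ∀ {T v} → T ∈ Cs → hangs T ≡ true → v ∈ᵥ T → v ∈ᵥ branch
    hanging⇒∈branch {T} {v} T∈ h vT = trans (lookup∘tabulate in-branch v)
      (∨-trueʳ (at-xy v) (any-true⁺ (λ T → lookup T v ∧ hangs T) T∈ (cong₂ _∧_ vT h)))

    branch-≢z : ∀ v → v ∈ᵥ branch → not (v == z) ≡ true
    branch-≢z v v∈ with branch⁻ v∈
    ... | inj₁ at = cong not (≢⇒==-false λ { refl → not-¬ (at-xy⇒∈Γ at) (Graph.irrefl H z) })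
    ... | inj₂ (T , T∈ , vT , _) = tree-vertex-≢z T∈ vT

    branch-acyclic : (∀ {T} → T ∈ Cs → hangs T ≡ true → SinglyAttached T) → ¬ Cycle (_∈ᵥ branch)
    branch-acyclic single c =
      ¬cycle-within-pair c x y (All.zipWith only-xy (All.tabulate (λ v∈c → v∈c) , inside c))
      where
      only-xy : ∀ {v} → v ∈ vertices c × v ∈ᵥ branch → v ≡ x ⊎ v ≡ y
      only-xy {v} (v∈c , v∈) with branch⁻ v∈
      ... | inj₁ at = at-xy⁻ {v} at
      ... | inj₂ (T , T∈ , vT , h) =
        ⊥-elim (cycle-avoids-singly-attached branch-≢z T∈ (single T∈ h) c (Any.map (λ { refl → vT }) v∈c))

    record IsTreeBranch : Set where
      field
        Γ-closed         : ∀ u v → at-xy u ≡ true → adj H z v ≡ true → adj H u v ≡ true →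
                           v ∈ᵥ branch
        outer-closed     : ∀ u v → at-xy u ≡ true → not (v == z) ≡ true → adj H z v ≡ false →
                           adj H u v ≡ true → v ∈ᵥ branch
        hanging-Γ-closed : ∀ {T} → T ∈ Cs → hangs T ≡ true →
                           ∀ t v → t ∈ᵥ T → adj H z v ≡ true → adj H t v ≡ true → v ∈ᵥ branch
        x⇝y              : Walk H branch x y
        acyclic          : ¬ Cycle (_∈ᵥ branch)

    tree-branch⇒⊥ : IsTreeBranch → ⊥
    tree-branch⇒⊥ tb = no-tree branch (component , λ hc → acyclic (HasCycle⇒Cycle {C = branch} hc))
      where
      open IsTreeBranch tb

      x⇝at-xy : ∀ {v} → at-xy v ≡ true → Walk H branch x v
      x⇝at-xy {v} at with at-xy⁻ {v} at
      ... | inj₁ refl = []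
      ... | inj₂ refl = x⇝y

      x⇝ : ∀ v → v ∈ᵥ branch → Walk H branch x v
      x⇝ v v∈ with branch⁻ v∈
      ... | inj₁ at = x⇝at-xy at
      ... | inj₂ (T , T∈ , vT , h) =
        x⇝at-xy h ++ʷ step (root-foot-adj T∈) (hanging⇒∈branch T∈ h (foot-∈T T∈))
          (mapʷ (λ _ → hanging⇒∈branch T∈ h) (tree-connected T∈ (foot T) v (foot-∈T T∈) vT))

      branch-closed : ∀ u v → u ∈ᵥ branch → minusZ H z v ≡ true → adj H u v ≡ true → v ∈ᵥ branch
      branch-closed u v u∈ v≢z uv with branch⁻ u∈ | false-or-true (adj H z v)
      ... | inj₁ at                  | inj₂ zv = Γ-closed u v at zv uv
      ... | inj₁ at                  | inj₁ zv = outer-closed u v at v≢z zv uv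
      ... | inj₂ (T , T∈ , uT , h) | inj₂ zv = hanging-Γ-closed T∈ h u v uT zv uv
      ... | inj₂ (T , T∈ , uT , h) | inj₁ zv = hanging⇒∈branch T∈ h (tree-closed T∈ u v uT v≢z zv uv)

      component : IsComponent H (minusZ H z) branch
      component = record
        { inS       = branch-≢z
        ; nonempty  = x , at-xy⇒∈branch at-x
        ; connected = λ u v u∈ v∈ → reverseʷ (x⇝ u u∈) (at-xy⇒∈branch at-x) ++ʷ x⇝ v v∈
        ; closed    = branch-closed
        }

    anchor-at-xy⇒∈branch : ∀ {u v} → at-xy u ≡ true → (u , v) ∈ anchors → v ∈ᵥ branch
    anchor-at-xy⇒∈branch at e∈ with anchor-of-tree e∈
    ... | T , T∈ , vT , refl = hanging⇒∈branch T∈ at vT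

    hanging-root⇒∈branch : ∀ {T v} → v ≡ root T → hangs T ≡ true → v ∈ᵥ branch
    hanging-root⇒∈branch refl = at-xy⇒∈branch

  no-ΓΓ-edge : (∀ e → ΓΓ-edge e ≡ true → ⊥) →
               ∀ {a b} → adj H z a ≡ true → adj H z b ≡ true → adj H a b ≡ true → ⊥
  no-ΓΓ-edge none {a} {b} za zb ab with ΓΓ-intro za zb ab
  ... | inj₁ q = none (a , b) q
  ... | inj₂ q = none (b , a) q

  all-outer-edges-anchors⇒⊥ : ∀ x y → ΓΓ-edge (x , y) ≡ true ⊎ x ≡ y →
    adj H z x ≡ true → adj H z y ≡ true →
    (∀ e → ΓΓ-edge e ≡ true → e ≡ (x , y)) → (∀ e → ΓΓ²-edge e ≡ true → e ∈ anchors) → ⊥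
  all-outer-edges-anchors⇒⊥ x y xy zx zy only-xy anchored = tree-branch⇒⊥ record
    { Γ-closed         = Γ-closed
    ; outer-closed     = λ u v at v≢z zv uv →
                           anchor-at-xy⇒∈branch at (anchored _ (ΓΓ²-intro (at-xy⇒∈Γ at) uv v≢z zv))
    ; hanging-Γ-closed = λ T∈ h t v tT zv tv → hanging-root⇒∈branch (proj₁ (single T∈ h t v tT zv tv)) h
    ; x⇝y              = x⇝y xy
    ; acyclic          = branch-acyclic single
    }
    where
    open Branch x y zx zy

    single : ∀ {T} → T ∈ Cs → hangs T ≡ true → SinglyAttached T
    single T∈ _ = entered-only-by-anchors⇒singly-attached T∈ (λ v t _ q → anchored _ q)

    Γ-closed : ∀ u v → at-xy u ≡ true → adj H z v ≡ true → adj H u v ≡ true → v ∈ᵥ branch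
    Γ-closed u v at zv uv with ΓΓ-intro (at-xy⇒∈Γ at) zv uv
    ... | inj₁ q with only-xy (u , v) q
    ...   | refl = at-xy⇒∈branch at-y
    Γ-closed u v at zv uv | inj₂ q with only-xy (v , u) q
    ...   | refl = at-xy⇒∈branch at-x

    x⇝y : ΓΓ-edge (x , y) ≡ true ⊎ x ≡ y → Walk H branch x y
    x⇝y (inj₁ q)    = step (proj₂ (proj₂ (ΓΓ-edge⁻ _ q))) (at-xy⇒∈branch at-y) []
    x⇝y (inj₂ refl) = []

  module OneExtraOuterEdge (x w : Fin n) (xw : ΓΓ²-edge (x , w) ≡ true)
    (no-ΓΓ : ∀ e → ΓΓ-edge e ≡ true → ⊥)
    (outer-edges : ∀ e → ΓΓ²-edge e ≡ true → e ∈ anchors ⊎ e ≡ (x , w)) where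

    zx : adj H z x ≡ true
    zx = proj₁ (ΓΓ²-edge⁻ (x , w) xw)

    entered-only-by-anchors : ∀ {T} → T ∈ Cs → lookup T w ≡ false →
                              ∀ v t → t ∈ᵥ T → ΓΓ²-edge (v , t) ≡ true → (v , t) ∈ anchors
    entered-only-by-anchors T∈ w∉T v t tT q with outer-edges (v , t) q
    ... | inj₁ anchored = anchored
    ... | inj₂ refl     = ⊥-elim (not-¬ tT w∉T)

    branch-at-y⇒⊥ : ∀ y → adj H z y ≡ true → y ≢ x →
                    (∀ {T} → T ∈ Cs → w ∈ᵥ T → root T ≢ y) → ⊥
    branch-at-y⇒⊥ y zy y≢x w-not-at-y = tree-branch⇒⊥ record
      { Γ-closed         = λ u v at zv uv → ⊥-elim (no-ΓΓ-edge no-ΓΓ (at-xy⇒∈Γ at) zv uv)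
      ; outer-closed     = outer-closed
      ; hanging-Γ-closed = λ T∈ h t v tT zv tv → hanging-root⇒∈branch (proj₁ (single T∈ h t v tT zv tv)) h
      ; x⇝y              = []
      ; acyclic          = branch-acyclic single
      }
      where
      open Branch y y zy zy

      at-y⇒≡y : ∀ {v} → at-xy v ≡ true → v ≡ y
      at-y⇒≡y {v} at with at-xy⁻ {v} at
      ... | inj₁ v≡y = v≡y
      ... | inj₂ v≡y = v≡y

      single : ∀ {T} → T ∈ Cs → hangs T ≡ true → SinglyAttached T
      single {T} T∈ h with false-or-true (lookup T w)
      ... | inj₁ w∉T = entered-only-by-anchors⇒singly-attached T∈ (entered-only-by-anchors T∈ w∉T)
      ... | inj₂ w∈T = ⊥-elim (w-not-at-y T∈ w∈T (at-y⇒≡y {root T} h))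

      outer-closed : ∀ u v → at-xy u ≡ true → not (v == z) ≡ true → adj H z v ≡ false →
                     adj H u v ≡ true → v ∈ᵥ branch
      outer-closed u v at v≢z zv uv with outer-edges (u , v) (ΓΓ²-intro (at-xy⇒∈Γ at) uv v≢z zv)
      ... | inj₁ anchored = anchor-at-xy⇒∈branch at anchored
      ... | inj₂ refl     = ⊥-elim (y≢x (sym (at-y⇒≡y {u} at)))

    module _ {Ts : Vec Bool n} (Ts∈ : Ts ∈ Cs) (wTs : w ∈ᵥ Ts)
             {y : Fin n} (root≡y : root Ts ≡ y) (y≢x : y ≢ x) where

      private
        zy : adj H z y ≡ true
        zy = subst (λ a → adj H z a ≡ true) root≡y (root-∈Γ Ts∈)

      In-x-y-Ts In-y-Ts : Fin n → Set
      In-x-y-Ts v = v ≡ x ⊎ v ≡ y ⊎ v ∈ᵥ Ts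
      In-y-Ts   v = v ≡ y ⊎ v ∈ᵥ Ts

      only-crossing-at-x : OnlyCrossing In-x-y-Ts (_== x) x w
      only-crossing-at-x p q _ Pq p==x q≠x pq with ==⇒≡ {u = p} p==x
      only-crossing-at-x p q _ (inj₁ refl)        _ q≠x pq | refl = ⊥-elim (not-¬ (==-refl q) q≠x)
      only-crossing-at-x p q _ (inj₂ (inj₁ refl)) _ q≠x pq | refl = ⊥-elim (no-ΓΓ-edge no-ΓΓ zx zy pq)
      only-crossing-at-x p q _ (inj₂ (inj₂ qTs))  _ q≠x pq | refl
        with outer-edges (x , q) (ΓΓ²-edge-into-tree Ts∈ qTs zx pq)
      ... | inj₁ anchored =
        ⊥-elim (y≢x (trans (sym root≡y) (cong proj₁ (anchor-into-tree Ts∈ qTs anchored))))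
      ... | inj₂ refl     = refl , refl

      only-crossing-at-y : OnlyCrossing In-y-Ts (_== y) y (foot Ts)
      only-crossing-at-y p q _ Pq p==y q≠y pq with ==⇒≡ {u = p} p==y
      only-crossing-at-y p q _ (inj₁ refl) _ q≠y pq | refl = ⊥-elim (not-¬ (==-refl q) q≠y)
      only-crossing-at-y p q _ (inj₂ qTs)  _ q≠y pq | refl
        with outer-edges (y , q) (ΓΓ²-edge-into-tree Ts∈ qTs zy pq)
      ... | inj₁ anchored = refl , cong proj₂ (sym (anchor-into-tree Ts∈ qTs anchored))
      ... | inj₂ refl     = ⊥-elim (y≢x refl)

      ¬cycle-in-y-Ts : ¬ Cycle In-y-Ts
      ¬cycle-in-y-Ts c with cycle-on-one-side (_== y) y (foot Ts) only-crossing-at-y c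
      ... | inj₁ all-y = ¬cycle-within-pair c y y (All.map (λ v==y → inj₁ (==⇒≡ v==y)) all-y)
      ... | inj₂ no-y  =
        tree-acyclic Ts∈ (Cycle⇒HasCycle {C = Ts} (restrict c (All.zipWith in-Ts (inside c , no-y))))
        where
        in-Ts : ∀ {v} → In-y-Ts v × (v == y) ≡ false → v ∈ᵥ Ts
        in-Ts {v} (inj₁ refl , v≠y) = ⊥-elim (not-¬ (==-refl v) v≠y)
        in-Ts     (inj₂ vTs  , _)   = vTs

      ¬cycle-in-x-y-Ts : ¬ Cycle In-x-y-Ts
      ¬cycle-in-x-y-Ts c with cycle-on-one-side (_== x) x w only-crossing-at-x c
      ... | inj₁ all-x = ¬cycle-within-pair c x x (All.map (λ v==x → inj₁ (==⇒≡ v==x)) all-x)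
      ... | inj₂ no-x  = ¬cycle-in-y-Ts (restrict c (All.zipWith in-y-Ts (inside c , no-x)))
        where
        in-y-Ts : ∀ {v} → In-x-y-Ts v × (v == x) ≡ false → In-y-Ts v
        in-y-Ts {v} (inj₁ refl , v≠x) = ⊥-elim (not-¬ (==-refl v) v≠x)
        in-y-Ts     (inj₂ v∈   , _)   = v∈

      branch-at-xy⇒⊥ : ⊥
      branch-at-xy⇒⊥ = tree-branch⇒⊥ record
        { Γ-closed         = λ u v at zv uv → ⊥-elim (no-ΓΓ-edge no-ΓΓ (at-xy⇒∈Γ at) zv uv)
        ; outer-closed     = outer-closed
        ; hanging-Γ-closed = hanging-Γ-closed
        ; x⇝y              = x⇝y
        ; acyclic          = λ c → ¬cycle-in-x-y-Ts (restrict c (cycle-in-x-y-Ts c))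
        }
        where
        open Branch x y zx zy

        Ts-hangs : hangs Ts ≡ true
        Ts-hangs = subst (λ a → at-xy a ≡ true) (sym root≡y) at-y

        outer-closed : ∀ u v → at-xy u ≡ true → not (v == z) ≡ true → adj H z v ≡ false →
                       adj H u v ≡ true → v ∈ᵥ branch
        outer-closed u v at v≢z zv uv with outer-edges (u , v) (ΓΓ²-intro (at-xy⇒∈Γ at) uv v≢z zv)
        ... | inj₁ anchored = anchor-at-xy⇒∈branch at anchored
        ... | inj₂ refl     = hanging⇒∈branch Ts∈ Ts-hangs wTs

        hanging-Γ-closed : ∀ {T} → T ∈ Cs → hangs T ≡ true →
                           ∀ t v → t ∈ᵥ T → adj H z v ≡ true → adj H t v ≡ true → v ∈ᵥ branch
        hanging-Γ-closed T∈ h t v tT zv tv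
          with outer-edges (v , t) (ΓΓ²-edge-into-tree T∈ tT zv (adj-sym tv))
        ... | inj₁ anchored = hanging-root⇒∈branch (cong proj₁ (sym (anchor-into-tree T∈ tT anchored))) h
        ... | inj₂ refl     = at-xy⇒∈branch at-x

        x⇝y : Walk H branch x y
        x⇝y = step (proj₂ (proj₂ (ΓΓ²-edge⁻ (x , w) xw))) (hanging⇒∈branch Ts∈ Ts-hangs wTs)
                (mapʷ (λ _ → hanging⇒∈branch Ts∈ Ts-hangs)
                      (tree-connected Ts∈ w (foot Ts) wTs (foot-∈T Ts∈))
                 ++ʷ step (subst (λ a → adj H (foot Ts) a ≡ true) root≡y (adj-sym (root-foot-adj Ts∈)))
                          (at-xy⇒∈branch at-y) [])

        cycle-in-x-y-Ts : (c : Cycle (_∈ᵥ branch)) → All In-x-y-Ts (vertices c)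
        cycle-in-x-y-Ts c = All.zipWith classify (All.tabulate (λ v∈c → v∈c) , inside c)
          where
          classify : ∀ {v} → v ∈ vertices c × v ∈ᵥ branch → In-x-y-Ts v
          classify {v} (v∈c , v∈) with branch⁻ v∈
          ... | inj₁ at with at-xy⁻ {v} at
          ...   | inj₁ v≡x = inj₁ v≡x
          ...   | inj₂ v≡y = inj₂ (inj₁ v≡y)
          classify {v} (v∈c , v∈) | inj₂ (T , T∈ , vT , h) with false-or-true (lookup T w)
          ...   | inj₂ w∈T = inj₂ (inj₂ (subst (v ∈ᵥ_) (same-tree T∈ Ts∈ w w∈T wTs) vT))
          ...   | inj₁ w∉T = ⊥-elim (cycle-avoids-singly-attached branch-≢z T∈
                    (entered-only-by-anchors⇒singly-attached T∈ (entered-only-by-anchors T∈ w∉T))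
                    c (Any.map (λ { refl → vT }) v∈c))

    -- Trees anchored at y are singly attached unless one of them contains w; then the branch at
    -- x and y, joined through xw, is a tree component instead.
    one-extra-outer-edge⇒⊥ : ∀ y → adj H z y ≡ true → y ≢ x → ⊥
    one-extra-outer-edge⇒⊥ y zy y≢x with Any.any? (λ T → (lookup T w ≟ᵇ true) ×-dec (root T ≟ y)) Cs
    ... | yes found with find found
    ...   | Ts , Ts∈ , wTs , root≡y = branch-at-xy⇒⊥ Ts∈ wTs root≡y y≢x
    one-extra-outer-edge⇒⊥ y zy y≢x | no none =
      branch-at-y⇒⊥ y zy y≢x (λ T∈ wT root≡y → none (Any.map (λ { refl → wT , root≡y }) T∈))

  Extra : Pair → Set
  Extra e = counted e ≡ true × e ∉ anchors

  extra? : ∀ e → Dec (Extra e)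
  extra? e = (counted e ≟ᵇ true) ×-dec ¬? (e ∈? anchors)
    where open DecMembership _≟ᵖ_ using (_∈?_)

  other-neighbour : ∀ {a b} → a ≢ b → adj H z a ≡ true → adj H z b ≡ true →
                    ∀ x → Σ (Fin n) λ y → adj H z y ≡ true × y ≢ x
  other-neighbour {a} {b} a≢b za zb x with a ≟ x
  ... | yes refl = b , zb , λ b≡a → a≢b (sym b≡a)
  ... | no  a≢x  = a , za , a≢x

  module _ (e₀ : Pair) (only-e₀ : ∀ e → Extra e → e ≡ e₀) where

    private
      only-ΓΓ : ∀ e → ΓΓ-edge e ≡ true → e ≡ e₀
      only-ΓΓ e q = only-e₀ e (cong (_∨ ΓΓ²-edge e) q , ΓΓ-edge-∉anchors q)

      not-ΓΓ : ΓΓ-edge e₀ ≡ false → ∀ e → ΓΓ-edge e ≡ true → ⊥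
      not-ΓΓ ¬q e q with only-ΓΓ e q
      ... | refl = not-¬ q ¬q

      outer-edge : ∀ e → ΓΓ²-edge e ≡ true → e ∈ anchors ⊎ e ≡ e₀
      outer-edge e q² with e ∈? anchors
        where open DecMembership _≟ᵖ_ using (_∈?_)
      ... | yes anchored = inj₁ anchored
      ... | no  e∉       = inj₂ (only-e₀ e (∨-trueʳ (ΓΓ-edge e) q² , e∉))

      anchored : ΓΓ²-edge e₀ ≡ false → ∀ e → ΓΓ²-edge e ≡ true → e ∈ anchors
      anchored ¬q² e q² with outer-edge e q²
      ... | inj₁ e∈ = e∈
      ... | inj₂ refl = ⊥-elim (not-¬ q² ¬q²)

    at-most-one-extra⇒⊥ : ∀ {a b} → a ≢ b → adj H z a ≡ true → adj H z b ≡ true → ⊥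
    at-most-one-extra⇒⊥ {a} a≢b za zb with false-or-true (ΓΓ²-edge e₀)
    ... | inj₂ q² with other-neighbour a≢b za zb (proj₁ e₀)
    ...   | y , zy , y≢x = OneExtraOuterEdge.one-extra-outer-edge⇒⊥ (proj₁ e₀) (proj₂ e₀) q²
                             (not-ΓΓ (ΓΓ²-edge⇒¬ΓΓ-edge e₀ q²)) outer-edge y zy y≢x
    at-most-one-extra⇒⊥ {a} a≢b za zb | inj₁ ¬q² with false-or-true (ΓΓ-edge e₀)
    ... | inj₂ q  = all-outer-edges-anchors⇒⊥ (proj₁ e₀) (proj₂ e₀) (inj₁ q)
                      (proj₁ (ΓΓ-edge⁻ e₀ q)) (proj₁ (proj₂ (ΓΓ-edge⁻ e₀ q)))
                      only-ΓΓ (anchored ¬q²)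
    ... | inj₁ ¬q = all-outer-edges-anchors⇒⊥ a a (inj₂ refl) za za
                      (λ e q → ⊥-elim (not-ΓΓ ¬q e q)) (anchored ¬q²)

  two-extra-edges : ∀ {a b} → a ≢ b → adj H z a ≡ true → adj H z b ≡ true →
                    Σ Pair λ e₁ → Σ Pair λ e₂ → e₁ ≢ e₂ × Extra e₁ × Extra e₂
  two-extra-edges a≢b za zb with Any.any? extra? pairs
  ... | no none = ⊥-elim (at-most-one-extra⇒⊥ (z , z)
                    (λ e x → ⊥-elim (none (Any.map (λ { refl → x }) (∈-pairs e)))) a≢b za zb)
  ... | yes some with find some
  ...   | e₁ , _ , x₁ with Any.any? (λ e → ¬? (e ≟ᵖ e₁) ×-dec extra? e) pairs
  ...     | yes other with find other
  ...       | e₂ , _ , e₂≢e₁ , x₂ = e₂ , e₁ , e₂≢e₁ , x₂ , x₁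
  two-extra-edges a≢b za zb | yes _ | e₁ , _ , _ | no none =
    ⊥-elim (at-most-one-extra⇒⊥ e₁ only-e₁ a≢b za zb)
    where
    only-e₁ : ∀ e → Extra e → e ≡ e₁
    only-e₁ e x with e ≟ᵖ e₁
    ... | yes e≡e₁ = e≡e₁
    ... | no  e≢e₁ = ⊥-elim (none (Any.map (λ { refl → e≢e₁ , x }) (∈-pairs e)))

  extras-and-anchors-counted : Unique Cs → ∀ {e₁ e₂} → e₁ ≢ e₂ → Extra e₁ → Extra e₂ →
                               length (e₁ ∷ e₂ ∷ anchors) ≤ countᴸ counted pairs
  extras-and-anchors-counted uq e₁≢e₂ (c₁ , e₁∉) (c₂ , e₂∉) =
    unique⇒length≤countᴸ _≟ᵖ_ counted pairs _
      ((e₁≢e₂ ∷ All.¬Any⇒All¬ anchors e₁∉) ∷ All.¬Any⇒All¬ anchors e₂∉ ∷ anchors-unique uq)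
      (All.tabulate (λ {e} _ → ∈-pairs e))
      (c₁ ∷ c₂ ∷ All.tabulate (λ e∈ → ∨-trueʳ _ (anchor-ΓΓ² e∈)))

lemma41 : (n : ℕ) (H : Graph n) (z : Fin n) →
          2 ≤ deg H z →
          (∀ C → ¬ IsTreeComponent H (minusZ H z) C) →
          (Cs : List (Vec Bool n)) → Unique Cs →
          All (IsTreeComponent H (minusZΓ H z)) Cs →
          length Cs + 2 ≤ m₁ H z + m₂ H z
lemma41 n H z two-neighbours no-tree Cs uq trees = bound
  where
  open TreeComponentsOfH-z-Γ H z no-tree Cs trees
  open ≤-Reasoning

  bound : length Cs + 2 ≤ m₁ H z + m₂ H z
  bound with countᴸ≥2⇒two-witnesses (adj H z) (allFin n) (allFin⁺ n) two-neighbours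
  ... | a , b , a≢b , za , zb with two-extra-edges a≢b za zb
  ...   | e₁ , e₂ , e₁≢e₂ , x₁ , x₂ = begin
    length Cs + 2               ≡⟨ +-comm (length Cs) 2 ⟩
    2 + length Cs               ≡⟨ cong (2 +_) (sym (length-map anchor Cs)) ⟩
    length (e₁ ∷ e₂ ∷ anchors)  ≤⟨ extras-and-anchors-counted uq e₁≢e₂ x₁ x₂ ⟩
    countᴸ counted pairs        ≤⟨ countᴸ-counted≤m₁+m₂ ⟩
    m₁ H z + m₂ H z             ∎
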